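{- For nonnegative integers $p,q$ and a positive integer $n$, let $c(p,q,n)$ be the number of planted trees on $n+1$ vertices having exactly $p$ crucial vertices and whose root has exactly $q$ children. Then $$c(p,q,n)=\#\{D\in\mathcal{D}_n : \mathrm{returns}(D)=p,\ \mathrm{rises}(D)=q\},$$ and consequently $$\sum_{p,q\ge 0} c(p,q,n)\,x^py^q=\sum_{D\in\mathcal{D}_n} x^{\mathrm{returns}(D)}y^{\mathrm{rises}(D)}.$$
   Context: A planted tree is a rooted tree in which the children of each vertex are linearly ordered (counted up to isomorphism preserving these orders). The generation of a vertex is its depth minus one (the root is in generation $-1$). Within a generation, vertices are ordered by birth order, which is the order in which they are visited by the depth-first preorder traversal (children visited in their linear order); the youngest member of a generation is the last in this order. A vertex $v$ is crucial if $v$ is the youngest member of its generation, $v$ has at least one child, and all other members of its generation have no children. $\mathcal{D}_n$ is the set of Dyck paths of length $2n$: sequences of $n$ north steps $N$ and $n$ east steps $E$ such that every prefix has no more $E$'s than $N$'s. The area sequence of $D$ is $(a_1,\ldots,a_n)$ with $a_i=i-x_i-1$, where $x_i$ is the number of east steps before the $i$-th north step. $\mathrm{rises}(D)$ is the number of north steps before the first east step, and $\mathrm{returns}(D)=\#\{1\le i\le n : a_i=0\}$ is the number of returns of $D$ to the main diagonal. -}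

module Defs where

open import Data.Nat using (ℕ; zero; suc; _+_; _∸_; _≤ᵇ_; _≡ᵇ_)
import Data.Nat as ℕ
open import Data.Bool using (Bool; true; false; _∧_; not; if_then_else_)
open import Data.List using (List; []; _∷_; map; _++_; length; filterᵇ; last; take; upTo)
import Data.List.Properties as LP
open import Data.Maybe using (Maybe; just; nothing)
open import Data.Product using (_×_; _,_; proj₁; proj₂; Σ)
open import Relation.Nullary using (does)
open import Relation.Binary.PropositionalEquality using (_≡_)

-- Planted trees: rooted trees with linearly ordered children.
-- Propositional equality on PTree is exactly isomorphism preserving
-- the child orders.

data PTree : Set where
  node : List PTree → PTree

children : PTree → List PTree
children (node ts) = ts

outdeg : PTree → ℕ
outdeg t = length (children t)

-- A vertex is identified by its address: the list of child indices
-- on the path from the root (root = []).  Its depth is the length of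
-- the address; its generation is depth - 1.
Address : Set
Address = List ℕ

allB : {A : Set} → (A → Bool) → List A → Bool
allB p [] = true
allB p (x ∷ xs) = p x ∧ allB p xs

addr-eq : Address → Address → Bool
addr-eq a b = does (LP.≡-dec ℕ._≟_ a b)

mutual
  preorder : PTree → List (Address × PTree)
  preorder (node ts) = ([] , node ts) ∷ preorderL 0 ts

  preorderL : ℕ → List PTree → List (Address × PTree)
  preorderL i [] = []
  preorderL i (t ∷ ts) =
    map (λ v → (i ∷ proj₁ v) , proj₂ v) (preorder t) ++ preorderL (suc i) ts

size : PTree → ℕ
size t = length (preorder t)

rootDeg : PTree → ℕ
rootDeg = outdeg

-- members of the generation of v, in birth (preorder) order
generationOf : PTree → Address → List (Address × PTree)
generationOf t a = filterᵇ (λ u → length (proj₁ u) ≡ᵇ length a) (preorder t)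

isYoungest : PTree → Address → Bool
isYoungest t a with last (generationOf t a)
... | nothing = false
... | just u = addr-eq (proj₁ u) a

isCrucial : PTree → Address × PTree → Bool
isCrucial t v =
  isYoungest t (proj₁ v)
  ∧ not (outdeg (proj₂ v) ≡ᵇ 0)
  ∧ allB (λ u → addr-eq (proj₁ u) (proj₁ v) Data.Bool.∨ (outdeg (proj₂ u) ≡ᵇ 0))
        (generationOf t (proj₁ v))

crucialCount : PTree → ℕ
crucialCount t = length (filterᵇ (isCrucial t) (preorder t))

data Step : Set where
  N E : Step

isN isE : Step → Bool
isN N = true
isN E = false
isE s = not (isN s)

countN countE : List Step → ℕ
countN w = length (filterᵇ isN w)
countE w = length (filterᵇ isE w)

ballot : List Step → Bool
ballot w = allB (λ k → countE (take k w) ≤ᵇ countN (take k w)) (upTo (suc (length w)))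

isDyck : ℕ → List Step → Bool
isDyck n w = (countN w ≡ᵇ n) ∧ (countE w ≡ᵇ n) ∧ ballot w

record Dyck (n : ℕ) : Set where
  constructor mkDyck
  field
    word  : List Step
    valid : isDyck n word ≡ true

-- area sequence: a_i = i - x_i - 1, x_i = number of E steps before the
-- i-th N step.  Helper: i = number of N steps seen so far, x = number of
-- E steps seen so far.
areaGo : ℕ → ℕ → List Step → List ℕ
areaGo i x [] = []
areaGo i x (N ∷ w) = (suc i ∸ x ∸ 1) ∷ areaGo (suc i) x w
areaGo i x (E ∷ w) = areaGo i (suc x) w

areaSeq : List Step → List ℕ
areaSeq = areaGo 0 0

risesW : List Step → ℕ
risesW [] = 0
risesW (N ∷ w) = suc (risesW w)
risesW (E ∷ w) = 0

returnsW : List Step → ℕ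
returnsW w = length (filterᵇ (λ a → a ≡ᵇ 0) (areaSeq w))

rises : ∀ {n} → Dyck n → ℕ
rises D = risesW (Dyck.word D)

returns : ∀ {n} → Dyck n → ℕ
returns D = returnsW (Dyck.word D)

module Submission where

-- A planted tree  node cs  is encoded by breadth-first search.  The forest
-- cs is processed as a queue: each dequeued vertex with e children
-- contributes the steps  E N^e  and enqueues its children, while the root
-- contributes the initial run  N^(length cs).  The height of the path after
-- a vertex is the length of the queue, so the word is a Dyck path, it is
-- decoded by reading the degree sequence backwards (Łukasiewicz
-- correspondence), and its first run of N's is the root degree (rises).
-- A north step starts on the diagonal (a_i = 0) exactly when the dequeued
-- vertex leaves the queue empty and has a child.  Inside a generation the
-- queue runs empty exactly when every member but the youngest is a leaf and
-- the youngest is not, i.e. when the generation has a crucial vertex.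

open import Defs
open import Data.Nat using (ℕ; zero; suc; pred; _+_; _∸_; _≤_; _<_; _≡ᵇ_; _≤ᵇ_; z≤n; s≤s)
open import Data.Nat.Properties
  using ( +-identityʳ; +-suc; +-comm; +-assoc; +-commutativeSemigroup; ≤-refl; ≤-trans
        ; ≤-reflexive; ≤-pred; m≤m+n; m≤n+m; n≤1+n; 1+n≰n; m∸n≤m; m+n∸n≡m; m+n∸m≡n
        ; m+n≤o⇒n≤o; m+n≤o⇒m≤o∸n; m≤n⇒m⊓n≡m; suc-injective; ≡ᵇ⇒≡; ≡⇒≡ᵇ; ≡-irrelevant; _≟_ )
open import Algebra.Properties.CommutativeSemigroup +-commutativeSemigroup using (interchange; x∙yz≈y∙xz)
open import Data.Bool using (Bool; true; false; _∧_; _∨_; not)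
open import Data.Bool.Properties using (T-≡; ∧-conicalˡ; ∧-conicalʳ; ∧-comm; ∧-identityʳ)
import Data.Bool.Properties as Bool
open import Data.List
  using (List; []; _∷_; _++_; _∷ʳ_; length; map; filterᵇ; last; take; drop; upTo; applyUpTo
        ; concatMap; replicate; initLast; _∷ʳ′_)
open import Data.List.Properties
  using ( length-++; length-map; length-take; length-drop; ++-identityʳ; ++-assoc
        ; take++drop≡id; map-++; map-∘; filter-++; concatMap-++; ∷-injectiveˡ; ∷-injectiveʳ
        ; length-++-sucʳ; ≡-dec )
open import Data.List.Relation.Unary.All using (All; []; _∷_)
import Data.List.Relation.Unary.All as All
import Data.List.Relation.Unary.All.Properties as All
open import Data.List.Relation.Unary.AllPairs using (AllPairs; []; _∷_)
import Data.List.Relation.Unary.AllPairs as AllPairs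
import Data.List.Relation.Unary.AllPairs.Properties as AllPairs
open import Data.Maybe using (just; nothing; maybe′)
open import Data.Product using (Σ; _×_; _,_; proj₁; proj₂; map₁; uncurry)
open import Data.Empty using (⊥)
open import Function using (_∘_)
open import Function.Bundles using (_↔_; mk↔ₛ′; Equivalence)
open import Relation.Nullary.Decidable using (T?; dec-true; dec-false)
open import Relation.Binary.PropositionalEquality
  using (_≡_; _≢_; refl; sym; trans; cong; cong₂; subst; ≢-sym; module ≡-Reasoning)
import Axiom.UniquenessOfIdentityProofs as UIP

open ≡-Reasoning

ind : Bool → ℕ
ind true = 1
ind false = 0

≡ᵇ-true⇒≡ : ∀ m n → (m ≡ᵇ n) ≡ true → m ≡ n
≡ᵇ-true⇒≡ m n eq = ≡ᵇ⇒≡ m n (Equivalence.from T-≡ eq)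

≡⇒≡ᵇ-true : ∀ m n → m ≡ n → (m ≡ᵇ n) ≡ true
≡⇒≡ᵇ-true m n eq = Equivalence.to T-≡ (≡⇒≡ᵇ m n eq)

addr-eq-refl : ∀ a → addr-eq a a ≡ true
addr-eq-refl a = dec-true (≡-dec _≟_ a a) refl

addr-eq-≢ : ∀ a b → a ≢ b → addr-eq a b ≡ false
addr-eq-≢ a b = dec-false (≡-dec _≟_ a b)

allB-++ : ∀ {A : Set} (p : A → Bool) xs ys → allB p (xs ++ ys) ≡ allB p xs ∧ allB p ys
allB-++ p [] ys = refl
allB-++ p (x ∷ xs) ys = trans (cong (p x ∧_) (allB-++ p xs ys)) (sym (Bool.∧-assoc (p x) _ _))

allB-cong : ∀ {A : Set} {p q : A → Bool} {xs} → All (λ x → p x ≡ q x) xs → allB p xs ≡ allB q xs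
allB-cong [] = refl
allB-cong (e ∷ es) = cong₂ _∧_ e (allB-cong es)

allB-map : ∀ {A B : Set} (p : B → Bool) (f : A → B) xs → allB p (map f xs) ≡ allB (p ∘ f) xs
allB-map p f [] = refl
allB-map p f (x ∷ xs) = cong (p (f x) ∧_) (allB-map p f xs)

allB-applyUpTo : ∀ (g : ℕ → Bool) f n → allB g (applyUpTo f n) ≡ allB (g ∘ f) (upTo n)
allB-applyUpTo g f zero = refl
allB-applyUpTo g f (suc n) = cong (g (f 0) ∧_)
  (trans (allB-applyUpTo g (f ∘ suc) n) (sym (allB-applyUpTo (g ∘ f) suc n)))

filterᵇ-++ : ∀ {A : Set} (p : A → Bool) xs ys → filterᵇ p (xs ++ ys) ≡ filterᵇ p xs ++ filterᵇ p ys
filterᵇ-++ p = filter-++ (T? ∘ p)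

filterᵇ-map : ∀ {A B : Set} (p : B → Bool) (f : A → B) xs →
  filterᵇ p (map f xs) ≡ map f (filterᵇ (p ∘ f) xs)
filterᵇ-map p f [] = refl
filterᵇ-map p f (x ∷ xs) with p (f x)
... | true = cong (f x ∷_) (filterᵇ-map p f xs)
... | false = filterᵇ-map p f xs

filterᵇ-cong : ∀ {A : Set} {p q : A → Bool} {xs} → All (λ x → p x ≡ q x) xs → filterᵇ p xs ≡ filterᵇ q xs
filterᵇ-cong {xs = []} [] = refl
filterᵇ-cong {p = p} {q} {x ∷ xs} (e ∷ es) with p x | q x
... | true | true = cong (x ∷_) (filterᵇ-cong es)
... | false | false = filterᵇ-cong es

filterᵇ-none : ∀ {A : Set} (p : A → Bool) {xs} → All (λ x → p x ≡ false) xs → filterᵇ p xs ≡ []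
filterᵇ-none p [] = refl
filterᵇ-none p {x ∷ xs} (e ∷ es) with p x
... | false = filterᵇ-none p es

length-filterᵇ-∷ : ∀ {A : Set} (p : A → Bool) x xs →
  length (filterᵇ p (x ∷ xs)) ≡ ind (p x) + length (filterᵇ p xs)
length-filterᵇ-∷ p x xs with p x
... | true = refl
... | false = refl

filterᵇ-sound : ∀ {A : Set} (p : A → Bool) xs → All (λ x → p x ≡ true) (filterᵇ p xs)
filterᵇ-sound p xs = All.map (Equivalence.to T-≡) (All.all-filter (T? ∘ p) xs)

last-∷ʳ : ∀ {A : Set} (ys : List A) z → last (ys ∷ʳ z) ≡ just z
last-∷ʳ [] z = refl
last-∷ʳ (y ∷ []) z = refl
last-∷ʳ (y ∷ y′ ∷ ys) z = last-∷ʳ (y′ ∷ ys) z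

take-++ : ∀ {A : Set} (xs ys : List A) → take (length xs) (xs ++ ys) ≡ xs
take-++ [] ys = refl
take-++ (x ∷ xs) ys = cong (x ∷_) (take-++ xs ys)

drop-++ : ∀ {A : Set} (xs ys : List A) → drop (length xs) (xs ++ ys) ≡ ys
drop-++ [] ys = refl
drop-++ (x ∷ xs) ys = drop-++ xs ys

mutual
  treeSize : PTree → ℕ
  treeSize (node ts) = suc (forestSize ts)

  forestSize : List PTree → ℕ
  forestSize [] = 0
  forestSize (t ∷ ts) = treeSize t + forestSize ts

forestSize-++ : ∀ xs ys → forestSize (xs ++ ys) ≡ forestSize xs + forestSize ys
forestSize-++ [] ys = refl
forestSize-++ (x ∷ xs) ys =
  trans (cong (treeSize x +_) (forestSize-++ xs ys)) (sym (+-assoc (treeSize x) _ _))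

-- Dequeuing  node cs  from the queue  node cs ∷ ts  and enqueuing cs
-- removes exactly one vertex.
forestSize-dequeue : ∀ cs ts → forestSize (ts ++ cs) ≡ forestSize cs + forestSize ts
forestSize-dequeue cs ts = trans (forestSize-++ ts cs) (+-comm (forestSize ts) _)

dequeue-fuel : ∀ cs ts {f} → forestSize (node cs ∷ ts) ≤ suc f → forestSize (ts ++ cs) ≤ f
dequeue-fuel cs ts le = ≤-trans (≤-reflexive (forestSize-dequeue cs ts)) (≤-pred le)

-- The occurrence of a vertex (address and subtree) as seen from the parent
-- of the tree it lives in, that tree being the parent's i-th child.
push : ℕ → Address × PTree → Address × PTree
push i v = (i ∷ proj₁ v) , proj₂ v

mutual
  size≡treeSize : ∀ t → size t ≡ treeSize t
  size≡treeSize (node ts) = cong suc (length-preorderL 0 ts)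

  length-preorderL : ∀ i ts → length (preorderL i ts) ≡ forestSize ts
  length-preorderL i [] = refl
  length-preorderL i (t ∷ ts) = trans (length-++ (map (push i) (preorder t)))
    (cong₂ _+_ (trans (length-map (push i) (preorder t)) (size≡treeSize t))
               (length-preorderL (suc i) ts))

sumTo : ℕ → (ℕ → ℕ) → ℕ
sumTo zero g = 0
sumTo (suc K) g = g 0 + sumTo K (g ∘ suc)

sumTo-cong : ∀ K {g h : ℕ → ℕ} → (∀ k → g k ≡ h k) → sumTo K g ≡ sumTo K h
sumTo-cong zero e = refl
sumTo-cong (suc K) e = cong₂ _+_ (e 0) (sumTo-cong K (e ∘ suc))

sumTo-zero : ∀ K {g : ℕ → ℕ} → (∀ k → g k ≡ 0) → sumTo K g ≡ 0
sumTo-zero zero e = refl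
sumTo-zero (suc K) e = cong₂ _+_ (e 0) (sumTo-zero K (e ∘ suc))

sumTo-+ : ∀ K (g h : ℕ → ℕ) → sumTo K (λ k → g k + h k) ≡ sumTo K g + sumTo K h
sumTo-+ zero g h = refl
sumTo-+ (suc K) g h = trans (cong (g 0 + h 0 +_) (sumTo-+ K (g ∘ suc) (h ∘ suc)))
  (interchange (g 0) (h 0) _ _)

sumTo-point : ∀ K d b → d < K → sumTo K (λ k → ind ((d ≡ᵇ k) ∧ b)) ≡ ind b
sumTo-point (suc K) zero b _ = trans (cong (ind b +_) (sumTo-zero K (λ _ → refl))) (+-identityʳ (ind b))
sumTo-point (suc K) (suc d) b d<K = sumTo-point K d b (≤-pred d<K)

count-by-layer : ∀ {A : Set} (δ : A → ℕ) (Q : A → Bool) K xs → All (λ x → δ x < K) xs →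
  length (filterᵇ Q xs) ≡ sumTo K (λ k → length (filterᵇ Q (filterᵇ (λ x → δ x ≡ᵇ k) xs)))
count-by-layer δ Q K [] [] = sym (sumTo-zero K (λ _ → refl))
count-by-layer δ Q K (x ∷ xs) (x<K ∷ xs<K) = begin
  length (filterᵇ Q (x ∷ xs))
    ≡⟨ length-filterᵇ-∷ Q x xs ⟩
  ind (Q x) + length (filterᵇ Q xs)
    ≡⟨ cong₂ _+_ (sym (sumTo-point K (δ x) (Q x) x<K)) (count-by-layer δ Q K xs xs<K) ⟩
  sumTo K (λ k → ind ((δ x ≡ᵇ k) ∧ Q x)) + sumTo K (λ k → length (filterᵇ Q (layer k xs)))
    ≡⟨ sym (sumTo-+ K _ _) ⟩
  sumTo K (λ k → ind ((δ x ≡ᵇ k) ∧ Q x) + length (filterᵇ Q (layer k xs)))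
    ≡⟨ sumTo-cong K (λ k → sym (count-layer-∷ k)) ⟩
  sumTo K (λ k → length (filterᵇ Q (layer k (x ∷ xs)))) ∎
  where
  layer : ℕ → List _ → List _
  layer k = filterᵇ (λ y → δ y ≡ᵇ k)

  count-layer-∷ : ∀ k → length (filterᵇ Q (layer k (x ∷ xs)))
                      ≡ ind ((δ x ≡ᵇ k) ∧ Q x) + length (filterᵇ Q (layer k xs))
  count-layer-∷ k with δ x ≡ᵇ k
  ... | true = length-filterᵇ-∷ Q x (layer k xs)
  ... | false = refl

-- The forest q is traversed breadth-first as a queue: the head is
-- dequeued, its outdegree recorded and its children enqueued.  The fuel f
-- bounds the number of steps; f ≥ forestSize q suffices.
bfsDegrees : ℕ → List PTree → List ℕ
bfsDegrees zero q = []
bfsDegrees (suc f) [] = []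
bfsDegrees (suc f) (node cs ∷ ts) = length cs ∷ bfsDegrees f (ts ++ cs)

graft : ℕ → List PTree → List PTree
graft k q = node (drop k q) ∷ take k q

-- Inverse of bfsDegrees: rebuild the queue from the back; the head with d
-- children takes the last d trees of the queue rebuilt from the rest.
rebuild : List ℕ → List PTree
rebuild [] = []
rebuild (d ∷ ds) = graft (length (rebuild ds) ∸ d) (rebuild ds)

-- ds is the breadth-first degree sequence of a queue of m trees:
-- the queue never runs empty before the sequence ends, and ends empty.
isLuk : ℕ → List ℕ → Bool
isLuk m [] = m ≡ᵇ 0
isLuk zero (d ∷ ds) = false
isLuk (suc m) (d ∷ ds) = isLuk (m + d) ds

graft-++ : ∀ ts cs → graft (length ts) (ts ++ cs) ≡ node cs ∷ ts
graft-++ ts cs = cong₂ (λ c t → node c ∷ t) (drop-++ ts cs) (take-++ ts cs)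

length-graft : ∀ k q → k ≤ length q → length (graft k q) ≡ suc k
length-graft k q k≤ = cong suc (trans (length-take k q) (m≤n⇒m⊓n≡m k≤))

forestSize-graft : ∀ k q → forestSize (graft k q) ≡ suc (forestSize q)
forestSize-graft k q = cong suc (begin
  forestSize (drop k q) + forestSize (take k q) ≡⟨ +-comm (forestSize (drop k q)) _ ⟩
  forestSize (take k q) + forestSize (drop k q) ≡⟨ sym (forestSize-++ (take k q) (drop k q)) ⟩
  forestSize (take k q ++ drop k q)             ≡⟨ cong forestSize (take++drop≡id k q) ⟩
  forestSize q                                  ∎)

rebuild-bfsDegrees : ∀ f q → forestSize q ≤ f → rebuild (bfsDegrees f q) ≡ q
rebuild-bfsDegrees zero [] _ = refl
rebuild-bfsDegrees zero (node cs ∷ ts) ()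
rebuild-bfsDegrees (suc f) [] _ = refl
rebuild-bfsDegrees (suc f) (node cs ∷ ts) le = begin
  graft (length Q ∸ length cs) Q             ≡⟨ cong (λ q → graft (length q ∸ length cs) q) ih ⟩
  graft (length (ts ++ cs) ∸ length cs) (ts ++ cs)
    ≡⟨ cong (λ k → graft k (ts ++ cs))
         (trans (cong (_∸ length cs) (length-++ ts)) (m+n∸n≡m (length ts) (length cs))) ⟩
  graft (length ts) (ts ++ cs)               ≡⟨ graft-++ ts cs ⟩
  node cs ∷ ts                               ∎
  where
  Q = rebuild (bfsDegrees f (ts ++ cs))
  ih : Q ≡ ts ++ cs
  ih = rebuild-bfsDegrees f (ts ++ cs) (dequeue-fuel cs ts le)

bfsDegrees-isLuk : ∀ f q → forestSize q ≤ f → isLuk (length q) (bfsDegrees f q) ≡ true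
bfsDegrees-isLuk zero [] _ = refl
bfsDegrees-isLuk zero (node cs ∷ ts) ()
bfsDegrees-isLuk (suc f) [] _ = refl
bfsDegrees-isLuk (suc f) (node cs ∷ ts) le =
  subst (λ m → isLuk m (bfsDegrees f (ts ++ cs)) ≡ true) (length-++ ts)
    (bfsDegrees-isLuk f (ts ++ cs) (dequeue-fuel cs ts le))

length-bfsDegrees : ∀ f q → forestSize q ≤ f → length (bfsDegrees f q) ≡ forestSize q
length-bfsDegrees zero [] _ = refl
length-bfsDegrees zero (node cs ∷ ts) ()
length-bfsDegrees (suc f) [] _ = refl
length-bfsDegrees (suc f) (node cs ∷ ts) le =
  cong suc (trans (length-bfsDegrees f (ts ++ cs) (dequeue-fuel cs ts le)) (forestSize-dequeue cs ts))

length-rebuild : ∀ m ds → isLuk m ds ≡ true → length (rebuild ds) ≡ m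
length-rebuild m [] h = sym (≡ᵇ-true⇒≡ m 0 h)
length-rebuild (suc m) (d ∷ ds) h = begin
  length (graft k Q) ≡⟨ length-graft k Q (m∸n≤m (length Q) d) ⟩
  suc k              ≡⟨ cong suc (trans (cong (_∸ d) ih) (m+n∸n≡m m d)) ⟩
  suc m              ∎
  where
  Q = rebuild ds
  k = length Q ∸ d
  ih : length Q ≡ m + d
  ih = length-rebuild (m + d) ds h

forestSize-rebuild : ∀ ds → forestSize (rebuild ds) ≡ length ds
forestSize-rebuild [] = refl
forestSize-rebuild (d ∷ ds) =
  trans (forestSize-graft (length (rebuild ds) ∸ d) (rebuild ds)) (cong suc (forestSize-rebuild ds))

bfsDegrees-rebuild : ∀ ds m f → isLuk m ds ≡ true → length ds ≤ f → bfsDegrees f (rebuild ds) ≡ ds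
bfsDegrees-rebuild [] m zero _ _ = refl
bfsDegrees-rebuild [] m (suc f) _ _ = refl
bfsDegrees-rebuild (d ∷ ds) (suc m) (suc f) h le = begin
  bfsDegrees (suc f) (graft (length Q ∸ d) Q)
    ≡⟨ cong (λ k → bfsDegrees (suc f) (graft k Q)) (trans (cong (_∸ d) lenQ) (m+n∸n≡m m d)) ⟩
  length (drop m Q) ∷ bfsDegrees f (take m Q ++ drop m Q)
    ≡⟨ cong₂ _∷_ (trans (length-drop m Q) (trans (cong (_∸ m) lenQ) (m+n∸m≡n m d)))
                 (cong (bfsDegrees f) (take++drop≡id m Q)) ⟩
  d ∷ bfsDegrees f Q
    ≡⟨ cong (d ∷_) (bfsDegrees-rebuild ds (m + d) f h (≤-pred le)) ⟩
  d ∷ ds ∎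
  where
  Q = rebuild ds
  lenQ : length Q ≡ m + d
  lenQ = length-rebuild (m + d) ds h

degreesWord : List ℕ → List Step
degreesWord [] = []
degreesWord (e ∷ es) = E ∷ replicate e N ++ degreesWord es

-- every word is uniquely an initial run  N^d  followed by  degreesWord es
joinPath : ℕ → List ℕ → List Step
joinPath d es = replicate d N ++ degreesWord es

splitPath : List Step → ℕ × List ℕ
splitPath [] = 0 , []
splitPath (N ∷ w) = map₁ suc (splitPath w)
splitPath (E ∷ w) = 0 , uncurry _∷_ (splitPath w)

splitPath-joinPath : ∀ d es → splitPath (joinPath d es) ≡ (d , es)
splitPath-joinPath (suc d) es = cong (map₁ suc) (splitPath-joinPath d es)
splitPath-joinPath zero [] = refl
splitPath-joinPath zero (e ∷ es) = cong (λ p → 0 , uncurry _∷_ p) (splitPath-joinPath e es)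

joinPath-splitPath : ∀ w → uncurry joinPath (splitPath w) ≡ w
joinPath-splitPath [] = refl
joinPath-splitPath (N ∷ w) = cong (N ∷_) (joinPath-splitPath w)
joinPath-splitPath (E ∷ w) = cong (E ∷_) (joinPath-splitPath w)

validFrom : ℕ → List Step → Bool
validFrom h [] = h ≡ᵇ 0
validFrom h (N ∷ w) = validFrom (suc h) w
validFrom zero (E ∷ w) = false
validFrom (suc h) (E ∷ w) = validFrom h w

validFrom-run : ∀ h d r → validFrom h (replicate d N ++ r) ≡ validFrom (h + d) r
validFrom-run h zero r = cong (λ x → validFrom x r) (sym (+-identityʳ h))
validFrom-run h (suc d) r = trans (validFrom-run (suc h) d r) (cong (λ x → validFrom x r) (sym (+-suc h d)))

validFrom-degreesWord : ∀ m es → validFrom m (degreesWord es) ≡ isLuk m es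
validFrom-degreesWord m [] = refl
validFrom-degreesWord zero (e ∷ es) = refl
validFrom-degreesWord (suc m) (e ∷ es) =
  trans (validFrom-run m e (degreesWord es)) (validFrom-degreesWord (m + e) es)

validFrom-joinPath : ∀ d es → validFrom 0 (joinPath d es) ≡ isLuk d es
validFrom-joinPath d es = trans (validFrom-run 0 d (degreesWord es)) (validFrom-degreesWord d es)

countE-joinPath : ∀ d es → countE (joinPath d es) ≡ length es
countE-joinPath (suc d) es = countE-joinPath d es
countE-joinPath zero [] = refl
countE-joinPath zero (e ∷ es) = cong suc (countE-joinPath e es)

risesW-joinPath : ∀ d es → risesW (joinPath d es) ≡ d
risesW-joinPath (suc d) es = cong suc (risesW-joinPath d es)
risesW-joinPath zero [] = refl
risesW-joinPath zero (e ∷ es) = refl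

ballotTest : ℕ → List Step → ℕ → Bool
ballotTest h w k = countE (take k w) ≤ᵇ h + countN (take k w)

prefixBallot : ℕ → List Step → Bool
prefixBallot h w = allB (ballotTest h w) (upTo (suc (length w)))

≤ᵇ-suc : ∀ a b → (suc a ≤ᵇ suc b) ≡ (a ≤ᵇ b)
≤ᵇ-suc zero b = refl
≤ᵇ-suc (suc a) b = refl

prefixBallot-N : ∀ h w → prefixBallot h (N ∷ w) ≡ prefixBallot (suc h) w
prefixBallot-N h w = trans (allB-applyUpTo (ballotTest h (N ∷ w)) suc (suc (length w)))
  (allB-cong {p = ballotTest h (N ∷ w) ∘ suc} {ballotTest (suc h) w}
    (All.universal (λ k → cong (countE (take k w) ≤ᵇ_) (+-suc h (countN (take k w))))
                   (upTo (suc (length w)))))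

prefixBallot-E : ∀ h w → prefixBallot (suc h) (E ∷ w) ≡ prefixBallot h w
prefixBallot-E h w = trans (allB-applyUpTo (ballotTest (suc h) (E ∷ w)) suc (suc (length w)))
  (allB-cong {p = ballotTest (suc h) (E ∷ w) ∘ suc} {ballotTest h w}
    (All.universal (λ k → ≤ᵇ-suc (countE (take k w)) (h + countN (take k w))) (upTo (suc (length w)))))

validFrom-ballot : ∀ h w → validFrom h w ≡ prefixBallot h w ∧ (countE w ≡ᵇ h + countN w)
validFrom-ballot zero [] = refl
validFrom-ballot (suc h) [] = refl
validFrom-ballot h (N ∷ w) = trans (validFrom-ballot (suc h) w)
  (sym (cong₂ _∧_ (prefixBallot-N h w) (cong (countE w ≡ᵇ_) (+-suc h (countN w)))))
validFrom-ballot zero (E ∷ w) = refl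
validFrom-ballot (suc h) (E ∷ w) =
  trans (validFrom-ballot h w) (cong (_∧ (countE w ≡ᵇ h + countN w)) (sym (prefixBallot-E h w)))

isDyck⇒valid : ∀ n w → isDyck n w ≡ true → validFrom 0 w ≡ true × countE w ≡ n
isDyck⇒valid n w h = trans (validFrom-ballot 0 w) (cong₂ _∧_ bal (≡⇒≡ᵇ-true _ _ (trans cE (sym cN)))) , cE
  where
  rest = ∧-conicalʳ (countN w ≡ᵇ n) _ h
  cN = ≡ᵇ-true⇒≡ (countN w) n (∧-conicalˡ _ _ h)
  cE = ≡ᵇ-true⇒≡ (countE w) n (∧-conicalˡ (countE w ≡ᵇ n) _ rest)
  bal = ∧-conicalʳ (countE w ≡ᵇ n) _ rest

valid⇒isDyck : ∀ n w → validFrom 0 w ≡ true → countE w ≡ n → isDyck n w ≡ true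
valid⇒isDyck n w v cE =
  cong₂ _∧_ (≡⇒≡ᵇ-true _ n (trans (sym balance) cE)) (cong₂ _∧_ (≡⇒≡ᵇ-true _ n cE) (∧-conicalˡ _ _ v′))
  where
  v′ = trans (sym (validFrom-ballot 0 w)) v
  balance : countE w ≡ countN w
  balance = ≡ᵇ-true⇒≡ _ _ (∧-conicalʳ _ _ v′)

-- north steps of w taken from height 0, when w starts at height h
groundRises : ℕ → List Step → ℕ
groundRises h [] = 0
groundRises zero (N ∷ w) = suc (groundRises 1 w)
groundRises (suc h) (N ∷ w) = groundRises (suc (suc h)) w
groundRises h (E ∷ w) = groundRises (pred h) w

zeros : List ℕ → ℕ
zeros l = length (filterᵇ (λ a → a ≡ᵇ 0) l)

-- with x east steps seen and height h, the next north step has area h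
areaGo-N : ∀ x h w → areaGo (x + h) x (N ∷ w) ≡ h ∷ areaGo (x + suc h) x w
areaGo-N x h w = cong₂ _∷_
  (trans (cong (λ i → i ∸ x ∸ 1) (sym (+-suc x h))) (cong (_∸ 1) (m+n∸m≡n x (suc h))))
  (cong (λ i → areaGo i x w) (sym (+-suc x h)))

zeros-areaGo : ∀ x h w → validFrom h w ≡ true → zeros (areaGo (x + h) x w) ≡ groundRises h w
zeros-areaGo x h [] _ = refl
zeros-areaGo x zero (N ∷ w) v = trans (cong zeros (areaGo-N x 0 w)) (cong suc (zeros-areaGo x 1 w v))
zeros-areaGo x (suc h) (N ∷ w) v =
  trans (cong zeros (areaGo-N x (suc h) w)) (zeros-areaGo x (suc (suc h)) w v)
zeros-areaGo x (suc h) (E ∷ w) v =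
  trans (cong (λ i → zeros (areaGo i (suc x) w)) (+-suc x h)) (zeros-areaGo (suc x) h w v)

returnsW-groundRises : ∀ w → validFrom 0 w ≡ true → returnsW w ≡ groundRises 0 w
returnsW-groundRises = zeros-areaGo 0 0

groundStart : ℕ → ℕ → ℕ
groundStart h zero = 0
groundStart zero (suc d) = 1
groundStart (suc h) (suc d) = 0

groundRises-above : ∀ h d r → groundRises (suc h) (replicate d N ++ r) ≡ groundRises (suc h + d) r
groundRises-above h zero r = cong (λ x → groundRises x r) (sym (+-identityʳ (suc h)))
groundRises-above h (suc d) r =
  trans (groundRises-above (suc h) d r) (cong (λ x → groundRises x r) (sym (+-suc (suc h) d)))

groundRises-run : ∀ h d r → groundRises h (replicate d N ++ r) ≡ groundStart h d + groundRises (h + d) r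
groundRises-run h zero r = cong (λ x → groundRises x r) (sym (+-identityʳ h))
groundRises-run zero (suc d) r = cong suc (groundRises-above 0 d r)
groundRises-run (suc h) (suc d) r = groundRises-above h (suc d) r

bfsCrucial : ℕ → List PTree → ℕ
bfsCrucial zero q = 0
bfsCrucial (suc f) [] = 0
bfsCrucial (suc f) (node cs ∷ ts) = groundStart (length ts) (length cs) + bfsCrucial f (ts ++ cs)

bfsCrucial-[] : ∀ f → bfsCrucial f [] ≡ 0
bfsCrucial-[] zero = refl
bfsCrucial-[] (suc f) = refl

-- the queue length is the height of the path
bfsCrucial-groundRises : ∀ f q → bfsCrucial f q ≡ groundRises (length q) (degreesWord (bfsDegrees f q))
bfsCrucial-groundRises zero q = refl
bfsCrucial-groundRises (suc f) [] = refl
bfsCrucial-groundRises (suc f) (node cs ∷ ts) = begin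
  groundStart (length ts) (length cs) + bfsCrucial f (ts ++ cs)
    ≡⟨ cong (groundStart (length ts) (length cs) +_)
         (trans (bfsCrucial-groundRises f (ts ++ cs)) (cong (λ m → groundRises m W) (length-++ ts))) ⟩
  groundStart (length ts) (length cs) + groundRises (length ts + length cs) W
    ≡⟨ sym (groundRises-run (length ts) (length cs) W) ⟩
  groundRises (length ts) (replicate (length cs) N ++ W) ∎
  where
  W = degreesWord (bfsDegrees f (ts ++ cs))

offspring : List PTree → List PTree
offspring = concatMap children

level : List PTree → ℕ → List PTree
level F zero = F
level F (suc k) = level (offspring F) k

level-++ : ∀ xs ys k → level (xs ++ ys) k ≡ level xs k ++ level ys k
level-++ xs ys zero = refl
level-++ xs ys (suc k) =
  trans (cong (λ F → level F k) (concatMap-++ children xs ys)) (level-++ (offspring xs) (offspring ys) k)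

level-[] : ∀ k → level [] k ≡ []
level-[] zero = refl
level-[] (suc k) = level-[] k

forestSize-offspring : ∀ F → forestSize F ≡ length F + forestSize (offspring F)
forestSize-offspring [] = refl
forestSize-offspring (node cs ∷ F) = cong suc (begin
  forestSize cs + forestSize F                    ≡⟨ cong (forestSize cs +_) (forestSize-offspring F) ⟩
  forestSize cs + (length F + forestSize (offspring F)) ≡⟨ x∙yz≈y∙xz (forestSize cs) (length F) _ ⟩
  length F + (forestSize cs + forestSize (offspring F)) ≡⟨ cong (length F +_) (sym (forestSize-++ cs _)) ⟩
  length F + forestSize (cs ++ offspring F)        ∎)

-- Crucial vertices found while the queue runs through the generation L,
-- A being the part of the next generation enqueued so far.
levelCrucial : List PTree → List PTree → ℕ
levelCrucial [] A = 0
levelCrucial (node cs ∷ L) A = groundStart (length (L ++ A)) (length cs) + levelCrucial L (A ++ cs)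

-- Once a child has been enqueued the queue never runs empty in this generation.
levelCrucial-busy : ∀ L a A → levelCrucial L (a ∷ A) ≡ 0
levelCrucial-busy [] a A = refl
levelCrucial-busy (node [] ∷ L) a A = levelCrucial-busy L a (A ++ [])
levelCrucial-busy (node (c ∷ cs) ∷ L) a A rewrite length-++-sucʳ L a A = levelCrucial-busy L a (A ++ c ∷ cs)

isLeaf : PTree → Bool
isLeaf s = outdeg s ≡ᵇ 0

levelCrucial-snoc : ∀ ys s → levelCrucial (ys ∷ʳ s) [] ≡ ind (allB isLeaf ys ∧ not (isLeaf s))
levelCrucial-snoc [] (node []) = refl
levelCrucial-snoc [] (node (c ∷ cs)) = refl
levelCrucial-snoc (node [] ∷ ys) s = levelCrucial-snoc ys s
levelCrucial-snoc (node (c ∷ cs) ∷ ys) s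
  rewrite ++-identityʳ (ys ∷ʳ s) | length-++-sucʳ ys s [] = levelCrucial-busy (ys ∷ʳ s) c cs

bfsCrucial-level : ∀ L A f → length L ≤ f →
  bfsCrucial f (L ++ A) ≡ levelCrucial L A + bfsCrucial (f ∸ length L) (A ++ offspring L)
bfsCrucial-level [] A f _ = cong (bfsCrucial f) (sym (++-identityʳ A))
bfsCrucial-level (node cs ∷ L) A (suc f) le = begin
  g + bfsCrucial f ((L ++ A) ++ cs)
    ≡⟨ cong (λ q → g + bfsCrucial f q) (++-assoc L A cs) ⟩
  g + bfsCrucial f (L ++ (A ++ cs))
    ≡⟨ cong (g +_) (bfsCrucial-level L (A ++ cs) f (≤-pred le)) ⟩
  g + (levelCrucial L (A ++ cs) + bfsCrucial (f ∸ length L) ((A ++ cs) ++ offspring L))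
    ≡⟨ sym (+-assoc g _ _) ⟩
  g + levelCrucial L (A ++ cs) + bfsCrucial (f ∸ length L) ((A ++ cs) ++ offspring L)
    ≡⟨ cong (λ q → g + levelCrucial L (A ++ cs) + bfsCrucial (f ∸ length L) q) (++-assoc A cs _) ⟩
  g + levelCrucial L (A ++ cs) + bfsCrucial (f ∸ length L) (A ++ (cs ++ offspring L)) ∎
  where
  g = groundStart (length (L ++ A)) (length cs)

-- breadth-first search visits the generations one after the other
bfsCrucial-levels : ∀ K f F → forestSize F ≤ K → forestSize F ≤ f →
  bfsCrucial f F ≡ sumTo K (λ k → levelCrucial (level F k) [])
bfsCrucial-levels K f [] _ _ =
  trans (bfsCrucial-[] f) (sym (sumTo-zero K (λ k → cong (λ L → levelCrucial L []) (level-[] k))))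
bfsCrucial-levels (suc K) f F@(node cs ∷ F′) leK lef = begin
  bfsCrucial f F
    ≡⟨ cong (bfsCrucial f) (sym (++-identityʳ F)) ⟩
  bfsCrucial f (F ++ [])
    ≡⟨ bfsCrucial-level F [] f (≤-trans (≤-trans (m≤m+n _ _) (≤-reflexive (sym split))) lef) ⟩
  levelCrucial F [] + bfsCrucial (f ∸ length F) (offspring F)
    ≡⟨ cong (levelCrucial F [] +_) (bfsCrucial-levels K (f ∸ length F) (offspring F) boundK boundf) ⟩
  levelCrucial F [] + sumTo K (λ k → levelCrucial (level (offspring F) k) []) ∎
  where
  split = forestSize-offspring F
  boundK : forestSize (offspring F) ≤ K
  boundK = m+n≤o⇒n≤o (length F′) (≤-pred (≤-trans (≤-reflexive (sym split)) leK))
  boundf : forestSize (offspring F) ≤ f ∸ length F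
  boundf = m+n≤o⇒m≤o∸n _
    (≤-trans (≤-reflexive (+-comm _ (length F))) (≤-trans (≤-reflexive (sym split)) lef))

-- the members of generation k (addresses of length k), in birth order;
-- generationOf t a  is  generation (length a) (preorder t)
generation : ℕ → List (Address × PTree) → List (Address × PTree)
generation k = filterᵇ (λ u → length (proj₁ u) ≡ᵇ k)

generation-push : ∀ i k P → generation (suc k) (map (push i) P) ≡ map (push i) (generation k P)
generation-push i k = filterᵇ-map _ (push i)

generation-zero-push : ∀ i P → generation 0 (map (push i) P) ≡ []
generation-zero-push i [] = refl
generation-zero-push i (x ∷ P) = generation-zero-push i P

generation-zero-preorderL : ∀ i ts → generation 0 (preorderL i ts) ≡ []
generation-zero-preorderL i [] = refl
generation-zero-preorderL i (t ∷ ts) =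
  trans (filterᵇ-++ _ (map (push i) (preorder t)) (preorderL (suc i) ts))
  (cong₂ _++_ (generation-zero-push i (preorder t)) (generation-zero-preorderL (suc i) ts))

mutual
  generation-level : ∀ t k → map proj₂ (generation k (preorder t)) ≡ level (t ∷ []) k
  generation-level (node ts) zero = cong (λ G → node ts ∷ map proj₂ G) (generation-zero-preorderL 0 ts)
  generation-level (node ts) (suc k) =
    trans (generation-levelL 0 ts k) (cong (λ F → level F k) (sym (++-identityʳ ts)))

  generation-levelL : ∀ i ts k → map proj₂ (generation (suc k) (preorderL i ts)) ≡ level ts k
  generation-levelL i [] k = sym (level-[] k)
  generation-levelL i (t ∷ ts) k = begin
    map proj₂ (generation (suc k) (map (push i) P ++ preorderL (suc i) ts))
      ≡⟨ cong (map proj₂) (filterᵇ-++ _ (map (push i) P) _) ⟩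
    map proj₂ (generation (suc k) (map (push i) P) ++ generation (suc k) (preorderL (suc i) ts))
      ≡⟨ map-++ proj₂ (generation (suc k) (map (push i) P)) _ ⟩
    map proj₂ (generation (suc k) (map (push i) P)) ++ map proj₂ (generation (suc k) (preorderL (suc i) ts))
      ≡⟨ cong₂ _++_ first-child (generation-levelL (suc i) ts k) ⟩
    level (t ∷ []) k ++ level ts k
      ≡⟨ sym (level-++ (t ∷ []) ts k) ⟩
    level (t ∷ ts) k ∎
    where
    P = preorder t
    first-child : map proj₂ (generation (suc k) (map (push i) P)) ≡ level (t ∷ []) k
    first-child = begin
      map proj₂ (generation (suc k) (map (push i) P)) ≡⟨ cong (map proj₂) (generation-push i k P) ⟩
      map proj₂ (map (push i) (generation k P))       ≡⟨ sym (map-∘ (generation k P)) ⟩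
      map proj₂ (generation k P)                      ≡⟨ generation-level t k ⟩
      level (t ∷ []) k                                ∎

Distinct : List (Address × PTree) → Set
Distinct = AllPairs (λ u v → proj₁ u ≢ proj₁ v)

StartsFrom : ℕ → Address → Set
StartsFrom i [] = ⊥
StartsFrom i (j ∷ _) = i ≤ j

startsFrom-preorderL : ∀ i ts → All (StartsFrom i ∘ proj₁) (preorderL i ts)
startsFrom-preorderL i [] = []
startsFrom-preorderL i (t ∷ ts) =
  All.++⁺ (All.map⁺ (All.universal (λ _ → ≤-refl) (preorder t)))
          (All.map (λ {u} → weaken (proj₁ u)) (startsFrom-preorderL (suc i) ts))
  where
  weaken : ∀ a → StartsFrom (suc i) a → StartsFrom i a
  weaken (j ∷ a) le = ≤-trans (n≤1+n i) le

-- distinct children have disjoint address sets, the root address is []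
mutual
  distinct-preorder : ∀ t → Distinct (preorder t)
  distinct-preorder (node ts) =
    All.map (λ {u} → root≢ (proj₁ u)) (startsFrom-preorderL 0 ts) ∷ distinct-preorderL 0 ts
    where
    root≢ : ∀ a → StartsFrom 0 a → [] ≢ a
    root≢ (j ∷ a) _ ()

  distinct-preorderL : ∀ i ts → Distinct (preorderL i ts)
  distinct-preorderL i [] = []
  distinct-preorderL i (t ∷ ts) =
    AllPairs.++⁺ (AllPairs.map⁺ (AllPairs.map (λ ne eq → ne (∷-injectiveʳ eq)) (distinct-preorder t)))
                 (distinct-preorderL (suc i) ts)
                 (All.map⁺ (All.universal (λ v → All.map (λ {w} → later≢ (proj₁ v) (proj₁ w))
                                                         (startsFrom-preorderL (suc i) ts))
                                          (preorder t)))
    where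
    later≢ : ∀ a b → StartsFrom (suc i) b → (i ∷ a) ≢ b
    later≢ a (j ∷ b) le eq = 1+n≰n (subst (suc i ≤_) (sym (∷-injectiveˡ eq)) le)

mutual
  depth-bound : ∀ t → All (λ u → length (proj₁ u) < treeSize t) (preorder t)
  depth-bound (node ts) = s≤s z≤n ∷ All.map s≤s (depth-boundL 0 ts)

  depth-boundL : ∀ i ts → All (λ u → length (proj₁ u) ≤ forestSize ts) (preorderL i ts)
  depth-boundL i [] = []
  depth-boundL i (t ∷ ts) =
    All.++⁺ (All.map⁺ (All.map (λ lt → ≤-trans lt (m≤m+n _ _)) (depth-bound t)))
            (All.map (λ le → ≤-trans le (m≤n+m _ _)) (depth-boundL (suc i) ts))

youngestIn : List (Address × PTree) → Address → Bool
youngestIn G a = maybe′ (λ u → addr-eq (proj₁ u) a) false (last G)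

crucialTest : Address × PTree → Address × PTree → Bool
crucialTest v u = addr-eq (proj₁ u) (proj₁ v) ∨ isLeaf (proj₂ u)

crucialIn : List (Address × PTree) → Address × PTree → Bool
crucialIn G v = youngestIn G (proj₁ v) ∧ not (isLeaf (proj₂ v)) ∧ allB (crucialTest v) G

isYoungest≡youngestIn : ∀ t a → isYoungest t a ≡ youngestIn (generationOf t a) a
isYoungest≡youngestIn t a with last (generationOf t a)
... | nothing = refl
... | just u = refl

youngestIn-snoc : ∀ ys z a → youngestIn (ys ∷ʳ z) a ≡ addr-eq (proj₁ z) a
youngestIn-snoc ys z a = cong (maybe′ (λ u → addr-eq (proj₁ u) a) false) (last-∷ʳ ys z)

crucialIn-init : ∀ ys z → All (λ u → proj₁ u ≢ proj₁ z) ys →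
  All (λ u → crucialIn (ys ∷ʳ z) u ≡ false) ys
crucialIn-init ys z = All.map (λ {u} ne →
  cong (_∧ (not (isLeaf (proj₂ u)) ∧ allB (crucialTest u) (ys ∷ʳ z)))
       (trans (youngestIn-snoc ys z (proj₁ u)) (addr-eq-≢ _ _ (≢-sym ne))))

crucialIn-last : ∀ ys z → All (λ u → proj₁ u ≢ proj₁ z) ys →
  crucialIn (ys ∷ʳ z) z ≡ allB isLeaf (map proj₂ ys) ∧ not (isLeaf (proj₂ z))
crucialIn-last ys z ne = begin
  crucialIn (ys ∷ʳ z) z
    ≡⟨ cong (_∧ (hasChild ∧ allB R (ys ∷ʳ z)))
         (trans (youngestIn-snoc ys z (proj₁ z)) (addr-eq-refl (proj₁ z))) ⟩
  hasChild ∧ allB R (ys ∷ʳ z)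
    ≡⟨ cong (hasChild ∧_) (allB-++ R ys (z ∷ [])) ⟩
  hasChild ∧ (allB R ys ∧ (R z ∧ true))
    ≡⟨ cong (λ b → hasChild ∧ (allB R ys ∧ ((b ∨ isLeaf (proj₂ z)) ∧ true))) (addr-eq-refl (proj₁ z)) ⟩
  hasChild ∧ (allB R ys ∧ true)
    ≡⟨ cong (hasChild ∧_)
         (trans (∧-identityʳ _) (trans (allB-cong others) (sym (allB-map isLeaf proj₂ ys)))) ⟩
  hasChild ∧ allB isLeaf (map proj₂ ys)
    ≡⟨ ∧-comm hasChild _ ⟩
  allB isLeaf (map proj₂ ys) ∧ hasChild ∎
  where
  hasChild = not (isLeaf (proj₂ z))
  R = crucialTest z
  others : All (λ u → R u ≡ isLeaf (proj₂ u)) ys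
  others = All.map (λ {u} ne′ → cong (_∨ isLeaf (proj₂ u)) (addr-eq-≢ _ _ ne′)) ne

distinct-last : ∀ ys z → Distinct (ys ∷ʳ z) → All (λ u → proj₁ u ≢ proj₁ z) ys
distinct-last [] z _ = []
distinct-last (y ∷ ys) z (y≢ ∷ d) = All.head (All.++⁻ʳ ys y≢) ∷ distinct-last ys z d

crucialIn-count : ∀ G → Distinct G → length (filterᵇ (crucialIn G) G) ≡ levelCrucial (map proj₂ G) []
crucialIn-count G d with initLast G
... | [] = refl
... | ys ∷ʳ′ z = begin
  length (filterᵇ c (ys ∷ʳ z))
    ≡⟨ cong length (filterᵇ-++ c ys (z ∷ [])) ⟩
  length (filterᵇ c ys ++ filterᵇ c (z ∷ []))
    ≡⟨ cong (λ l → length (l ++ filterᵇ c (z ∷ []))) (filterᵇ-none c (crucialIn-init ys z ne)) ⟩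
  length (filterᵇ c (z ∷ []))
    ≡⟨ trans (length-filterᵇ-∷ c z []) (+-identityʳ _) ⟩
  ind (c z)
    ≡⟨ cong ind (crucialIn-last ys z ne) ⟩
  ind (allB isLeaf (map proj₂ ys) ∧ not (isLeaf (proj₂ z)))
    ≡⟨ sym (levelCrucial-snoc (map proj₂ ys) (proj₂ z)) ⟩
  levelCrucial (map proj₂ ys ∷ʳ proj₂ z) []
    ≡⟨ cong (λ L → levelCrucial L []) (sym (map-++ proj₂ ys (z ∷ []))) ⟩
  levelCrucial (map proj₂ (ys ∷ʳ z)) [] ∎
  where
  c = crucialIn (ys ∷ʳ z)
  ne = distinct-last ys z d

crucialCount-levels : ∀ t → crucialCount t ≡ sumTo (treeSize t) (λ k → levelCrucial (level (t ∷ []) k) [])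
crucialCount-levels t = begin
  length (filterᵇ (isCrucial t) P)
    ≡⟨ count-by-layer (λ u → length (proj₁ u)) (isCrucial t) (treeSize t) P (depth-bound t) ⟩
  sumTo (treeSize t) (λ k → length (filterᵇ (isCrucial t) (generation k P)))
    ≡⟨ sumTo-cong (treeSize t) per-generation ⟩
  sumTo (treeSize t) (λ k → levelCrucial (level (t ∷ []) k) []) ∎
  where
  P = preorder t

  same-generation : ∀ k → All (λ u → isCrucial t u ≡ crucialIn (generation k P) u) (generation k P)
  same-generation k = All.map (λ {u} e →
      trans (cong (_∧ (not (isLeaf (proj₂ u)) ∧ allB (crucialTest u) (generationOf t (proj₁ u))))
                  (isYoungest≡youngestIn t (proj₁ u)))
            (cong (λ m → crucialIn (generation m P) u) (≡ᵇ-true⇒≡ _ k e)))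
    (filterᵇ-sound _ P)

  per-generation : ∀ k →
    length (filterᵇ (isCrucial t) (generation k P)) ≡ levelCrucial (level (t ∷ []) k) []
  per-generation k = begin
    length (filterᵇ (isCrucial t) (generation k P))
      ≡⟨ cong length (filterᵇ-cong (same-generation k)) ⟩
    length (filterᵇ (crucialIn (generation k P)) (generation k P))
      ≡⟨ crucialIn-count (generation k P) (AllPairs.filter⁺ _ (distinct-preorder t)) ⟩
    levelCrucial (map proj₂ (generation k P)) []
      ≡⟨ cong (λ L → levelCrucial L []) (generation-level t k) ⟩
    levelCrucial (level (t ∷ []) k) [] ∎

crucialCount-bfs : ∀ t → crucialCount t ≡ bfsCrucial (treeSize t) (t ∷ [])
crucialCount-bfs t = trans (crucialCount-levels t)
  (sym (bfsCrucial-levels (treeSize t) (treeSize t) (t ∷ []) fits fits))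
  where
  fits = ≤-reflexive (+-identityʳ (treeSize t))

treeWord : PTree → List Step
treeWord (node cs) = joinPath (length cs) (bfsDegrees (forestSize cs) cs)

wordTree : List Step → PTree
wordTree w = node (rebuild (proj₂ (splitPath w)))

wordTree-treeWord : ∀ t → wordTree (treeWord t) ≡ t
wordTree-treeWord (node cs) =
  trans (cong (node ∘ rebuild ∘ proj₂) (splitPath-joinPath (length cs) (bfsDegrees (forestSize cs) cs)))
        (cong node (rebuild-bfsDegrees (forestSize cs) cs ≤-refl))

treeWord-valid : ∀ t → validFrom 0 (treeWord t) ≡ true
treeWord-valid (node cs) =
  trans (validFrom-joinPath (length cs) _) (bfsDegrees-isLuk (forestSize cs) cs ≤-refl)

treeWord-wordTree : ∀ w → validFrom 0 w ≡ true → treeWord (wordTree w) ≡ w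
treeWord-wordTree w v = begin
  joinPath (length Q) (bfsDegrees (forestSize Q) Q)
    ≡⟨ cong₂ joinPath (length-rebuild d es luk) (bfsDegrees-rebuild es d (forestSize Q) luk fuel) ⟩
  joinPath d es
    ≡⟨ joinPath-splitPath w ⟩
  w ∎
  where
  d = proj₁ (splitPath w)
  es = proj₂ (splitPath w)
  Q = rebuild es
  fuel : length es ≤ forestSize Q
  fuel = ≤-reflexive (sym (forestSize-rebuild es))
  luk : isLuk d es ≡ true
  luk = trans (sym (validFrom-joinPath d es)) (trans (cong (validFrom 0) (joinPath-splitPath w)) v)

size-treeWord : ∀ t → size t ≡ suc (countE (treeWord t))
size-treeWord (node cs) = trans (size≡treeSize (node cs))
  (cong suc (sym (trans (countE-joinPath (length cs) _) (length-bfsDegrees (forestSize cs) cs ≤-refl))))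

rises-treeWord : ∀ t → risesW (treeWord t) ≡ rootDeg t
rises-treeWord (node cs) = risesW-joinPath (length cs) _

returns-treeWord : ∀ t → returnsW (treeWord t) ≡ crucialCount t
returns-treeWord t@(node _) = begin
  returnsW (treeWord t)                      ≡⟨ returnsW-groundRises (treeWord t) (treeWord-valid t) ⟩
  groundRises 0 (treeWord t)                 ≡⟨ sym (bfsCrucial-groundRises (treeSize t) (t ∷ [])) ⟩
  bfsCrucial (treeSize t) (t ∷ [])           ≡⟨ sym (crucialCount-bfs t) ⟩
  crucialCount t                             ∎

treeToPath : ∀ p q n → Σ PTree (λ t → size t ≡ suc n × crucialCount t ≡ p × rootDeg t ≡ q)
  → Σ (Dyck n) (λ D → returns D ≡ p × rises D ≡ q)
treeToPath p q n (t , sz , cr , rd) =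
  mkDyck (treeWord t) (valid⇒isDyck n (treeWord t) (treeWord-valid t) eastSteps)
  , trans (returns-treeWord t) cr , trans (rises-treeWord t) rd
  where
  eastSteps : countE (treeWord t) ≡ n
  eastSteps = suc-injective (trans (sym (size-treeWord t)) sz)

pathToTree : ∀ p q n → Σ (Dyck n) (λ D → returns D ≡ p × rises D ≡ q)
  → Σ PTree (λ t → size t ≡ suc n × crucialCount t ≡ p × rootDeg t ≡ q)
pathToTree p q n (mkDyck w v , ret , ris) =
  wordTree w
  , trans (size-treeWord (wordTree w)) (cong suc (trans (cong countE back) (proj₂ dyck)))
  , trans (sym (returns-treeWord (wordTree w))) (trans (cong returnsW back) ret)
  , trans (sym (rises-treeWord (wordTree w))) (trans (cong risesW back) ris)
  where
  dyck = isDyck⇒valid n w v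
  back = treeWord-wordTree w (proj₁ dyck)

Σ-≡ : ∀ {A : Set} {P : A → Set} → (∀ {a} (x y : P a) → x ≡ y) →
  ∀ {a b} {x : P a} {y : P b} → a ≡ b → (a , x) ≡ (b , y)
Σ-≡ irr {x = x} {y} refl = cong (_ ,_) (irr x y)

≡×≡-irrelevant : ∀ {a b c d : ℕ} (x y : a ≡ b × c ≡ d) → x ≡ y
≡×≡-irrelevant (e , f) (e′ , f′) = cong₂ _,_ (≡-irrelevant e e′) (≡-irrelevant f f′)

≡×≡×≡-irrelevant : ∀ {a b c d e f : ℕ} (x y : a ≡ b × c ≡ d × e ≡ f) → x ≡ y
≡×≡×≡-irrelevant (e , r) (e′ , r′) = cong₂ _,_ (≡-irrelevant e e′) (≡×≡-irrelevant r r′)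

Dyck-≡ : ∀ {n w w′} {v : isDyck n w ≡ true} {v′ : isDyck n w′ ≡ true} → w ≡ w′ → mkDyck w v ≡ mkDyck w′ v′
Dyck-≡ {v = v} {v′} refl = cong (mkDyck _) (UIP.Decidable⇒UIP.≡-irrelevant Bool._≟_ v v′)

mainTheorem3 : (p q n : ℕ) → 1 ≤ n →
    (Σ PTree (λ t → size t ≡ suc n × crucialCount t ≡ p × rootDeg t ≡ q))
      ↔ (Σ (Dyck n) (λ D → returns D ≡ p × rises D ≡ q))
mainTheorem3 p q n _ = mk↔ₛ′ (treeToPath p q n) (pathToTree p q n) path-tree-path tree-path-tree
  where
  path-tree-path : ∀ y → treeToPath p q n (pathToTree p q n y) ≡ y
  path-tree-path (mkDyck w v , _) =
    Σ-≡ ≡×≡-irrelevant (Dyck-≡ (treeWord-wordTree w (proj₁ (isDyck⇒valid n w v))))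

  tree-path-tree : ∀ x → pathToTree p q n (treeToPath p q n x) ≡ x
  tree-path-tree (t , _) = Σ-≡ ≡×≡×≡-irrelevant (wordTree-treeWord t)
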